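{- Let $G=(V,E)$ be a graph, let $v$ be a vertex of $G$ with $N_3(v)\neq\emptyset$, and let $G'=(V',E')$ be the graph obtained from $G$ by applying Rule 1 to $v$, i.e., removing $N_2(v)$ and $N_3(v)$ and adding a new vertex $v'$ together with the edge $\{v,v'\}$. Then $\gamma(G)=\gamma(G')$.
   Context: Graphs are finite, undirected and simple; $\gamma(G)$ is the minimum size of a dominating set of $G$ (a set $D$ such that every vertex outside $D$ has a neighbor in $D$). $N(v)$ is the set of neighbors of $v$, $N[v]=N(v)\cup\{v\}$, and for sets $X\setminus Y=\{x\in X:x\notin Y\}$. Define $N_1(v)=\{u\in N(v): N(u)\setminus N[v]\neq\emptyset\}$, $N_2(v)=\{u\in N(v)\setminus N_1(v): N(u)\cap N_1(v)\neq\emptyset\}$, $N_3(v)=N(v)\setminus(N_1(v)\cup N_2(v))$. -}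

module Defs where

open import Level using (0ℓ)
open import Data.Nat using (ℕ; _≤_)
open import Data.Product using (Σ; ∃; ∃-syntax; _×_)
open import Data.Sum using (_⊎_)
open import Data.List using (List; length)
open import Data.List.Membership.Propositional using (_∈_)
open import Data.List.Relation.Unary.Unique.Propositional using (Unique)
open import Relation.Nullary using (¬_; Dec)
open import Relation.Binary.PropositionalEquality using (_≡_; _≢_)
open import Relation.Binary.Definitions using (DecidableEquality)

record Graph : Set₁ where
  field
    V       : Set
    _≟_     : DecidableEquality V
    enum    : List V
    complete : ∀ x → x ∈ enum
    Adj     : V → V → Set
    adj?    : ∀ x y → Dec (Adj x y)
    sym     : ∀ {x y} → Adj x y → Adj y x
    irrefl  : ∀ {x} → ¬ Adj x x

open Graph public

Dominating : (G : Graph) → List (V G) → Set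
Dominating G D = ∀ x → x ∈ D ⊎ (∃[ d ] (d ∈ D × Adj G x d))

IsDominationNumber : Graph → ℕ → Set
IsDominationNumber G k =
  (∃[ D ] (Unique D × Dominating G D × length D ≡ k)) ×
  (∀ D → Unique D → Dominating G D → k ≤ length D)

module _ (G : Graph) (v : V G) where
  N : V G → Set
  N u = Adj G v u

  Nc : V G → Set
  Nc u = u ≡ v ⊎ N u

  N₁ : V G → Set
  N₁ u = N u × (∃[ w ] (Adj G u w × ¬ Nc w))

  N₂ : V G → Set
  N₂ u = (N u × ¬ N₁ u) × (∃[ w ] (Adj G u w × N₁ w))

  N₃ : V G → Set
  N₃ u = N u × ¬ (N₁ u ⊎ N₂ u)

  Kept : V G → Set
  Kept u = ¬ (N₂ u ⊎ N₃ u)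

-- G' is (up to isomorphism) the graph obtained from G by Rule 1 at v:
-- its vertices are the kept vertices of G (embedded via emb) together with a
-- new vertex v', edges among kept vertices are those of G, and the only edge
-- at v' is {v, v'}.
record IsRule1 (G : Graph) (v : V G) (G' : Graph) : Set where
  field
    v'      : V G'
    emb     : V G → V G'
    emb-inj : ∀ a b → Kept G v a → Kept G v b → emb a ≡ emb b → a ≡ b
    emb-new : ∀ a → Kept G v a → emb a ≢ v'
    emb-sur : ∀ x → x ≢ v' → ∃[ a ] (Kept G v a × emb a ≡ x)
    emb-adj : ∀ a b → Kept G v a → Kept G v b →
              (Adj G' (emb a) (emb b) → Adj G a b) × (Adj G a b → Adj G' (emb a) (emb b))
    new-adj : ∀ a → Kept G v a →
              (Adj G' v' (emb a) → a ≡ v) × (a ≡ v → Adj G' v' (emb a))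

{-# OPTIONS --safe #-}
module Submission where

-- A vertex u ∈ N₃(v) has its whole closed neighbourhood in {v} ∪ N₂(v) ∪ N₃(v),
-- so every dominating set of G meets that set; sending all of it to v therefore
-- yields a dominating set of G' that contains v and so also dominates v'.
-- Conversely, a dominating set of G' must contain v or v'; replacing v' by v
-- gives a dominating set of G, since N₂(v) ∪ N₃(v) ⊆ N(v). Both maps never
-- enlarge a set, so the domination numbers agree.

open import Defs
open import Data.Nat using (ℕ; _≤_)
open import Data.Nat.Properties using (≤-trans; ≤-reflexive; ≤-antisym)
open import Data.Product using (∃; ∃-syntax; _×_; _,_; proj₁; proj₂)
open import Data.Sum using (_⊎_; inj₁; inj₂)
open import Data.Empty using (⊥-elim)
open import Data.List using (List; map; length; deduplicate)
open import Data.List.Properties using (length-deduplicate; length-map)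
open import Data.List.Membership.Propositional using (_∈_; lose)
open import Data.List.Membership.Propositional.Properties using (∈-map⁺; ∈-deduplicate⁺)
open import Data.List.Relation.Binary.Subset.Propositional using (_⊆_)
open import Data.List.Relation.Unary.Any using (any?; satisfied)
open import Data.List.Relation.Unary.Unique.Propositional using (Unique)
open import Data.List.Relation.Unary.Unique.DecPropositional.Properties using (deduplicate-!)
open import Relation.Nullary using (¬_; Dec; yes; no; ¬?)
open import Relation.Nullary.Decidable using (map′; _×-dec_; _⊎-dec_)
open import Relation.Binary.PropositionalEquality as ≡ using (_≡_; _≢_; refl; subst)

∈-map⁺-≡ : {A B : Set} {f : A → B} {x : A} {y : B} {xs : List A} →
  x ∈ xs → f x ≡ y → y ∈ map f xs
∈-map⁺-≡ x∈xs refl = ∈-map⁺ _ x∈xs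

∃-dec : (G : Graph) {P : V G → Set} → (∀ x → Dec (P x)) → Dec (∃ P)
∃-dec G P? = map′ satisfied (λ (x , px) → lose (complete G x) px) (any? P? (enum G))

Dominating-⊆ : (G : Graph) {D E : List (V G)} → D ⊆ E → Dominating G D → Dominating G E
Dominating-⊆ G D⊆E domD x with domD x
... | inj₁ x∈D = inj₁ (D⊆E x∈D)
... | inj₂ (d , d∈D , x~d) = inj₂ (d , D⊆E d∈D , x~d)

DominationTransfer : Graph → Graph → Set
DominationTransfer G H =
  ∀ D → Dominating G D → ∃[ E ] (Unique E × Dominating H E × length E ≤ length D)

DominationTransfer-map : (G H : Graph) (f : V G → V H) →
  (∀ D → Dominating G D → Dominating H (map f D)) → DominationTransfer G H
DominationTransfer-map G H f preserves D domD =
  deduplicate (_≟_ H) (map f D) ,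
  deduplicate-! (_≟_ H) (map f D) ,
  Dominating-⊆ H (∈-deduplicate⁺ (_≟_ H)) (preserves D domD) ,
  ≤-trans (length-deduplicate (_≟_ H) (map f D)) (≤-reflexive (length-map f D))

IsDominationNumber-transfer : (G H : Graph) {k : ℕ} →
  DominationTransfer G H → DominationTransfer H G →
  IsDominationNumber G k → IsDominationNumber H k
IsDominationNumber-transfer G H G→H H→G ((D , _ , domD , refl) , minimal)
  with G→H D domD
... | (E , uniqueE , domE , |E|≤|D|) =
  (E , uniqueE , domE , ≤-antisym |E|≤|D| (lowerBound E uniqueE domE)) , lowerBound
  where
  lowerBound : ∀ E → Unique E → Dominating H E → length D ≤ length E
  lowerBound E _ domE with H→G E domE
  ... | (F , uniqueF , domF , |F|≤|E|) = ≤-trans (minimal F uniqueF domF) |F|≤|E|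

module Neighbourhoods (G : Graph) (v : V G) where

  Removed : V G → Set
  Removed u = N₂ G v u ⊎ N₃ G v u

  Nc? : ∀ u → Dec (Nc G v u)
  Nc? u = _≟_ G u v ⊎-dec adj? G v u

  N₁? : ∀ u → Dec (N₁ G v u)
  N₁? u = adj? G v u ×-dec ∃-dec G (λ w → adj? G u w ×-dec ¬? (Nc? w))

  N₂? : ∀ u → Dec (N₂ G v u)
  N₂? u = (adj? G v u ×-dec ¬? (N₁? u)) ×-dec ∃-dec G (λ w → adj? G u w ×-dec N₁? w)

  N₃? : ∀ u → Dec (N₃ G v u)
  N₃? u = adj? G v u ×-dec ¬? (N₁? u ⊎-dec N₂? u)

  Removed? : ∀ u → Dec (Removed u)
  Removed? u = N₂? u ⊎-dec N₃? u

  Kept-v : Kept G v v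
  Kept-v (inj₁ ((v~v , _) , _)) = irrefl G v~v
  Kept-v (inj₂ (v~v , _))       = irrefl G v~v

  Removed⇒N : ∀ {u} → Removed u → N G v u
  Removed⇒N (inj₁ ((v~u , _) , _)) = v~u
  Removed⇒N (inj₂ (v~u , _))       = v~u

  Removed⇒¬N₁ : ∀ {u} → Removed u → ¬ N₁ G v u
  Removed⇒¬N₁ (inj₁ ((_ , ¬N₁u) , _)) = ¬N₁u
  Removed⇒¬N₁ (inj₂ (_ , ¬N₁⊎N₂u))    = λ N₁u → ¬N₁⊎N₂u (inj₁ N₁u)

  Removed-adj⇒Nc : ∀ {u w} → Removed u → Adj G u w → Nc G v w
  Removed-adj⇒Nc {w = w} removed-u u~w with Nc? w
  ... | yes Nc-w = Nc-w
  ... | no ¬Nc-w = ⊥-elim (Removed⇒¬N₁ removed-u (Removed⇒N removed-u , w , u~w , ¬Nc-w))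

  -- A kept neighbour w of u would lie in N₁(v), which would put u in N₂(v).
  N₃-adj⇒v⊎Removed : ∀ {u w} → N₃ G v u → Adj G u w → w ≡ v ⊎ Removed w
  N₃-adj⇒v⊎Removed {w = w} N₃u@(v~u , ¬N₁⊎N₂u) u~w with Removed-adj⇒Nc (inj₂ N₃u) u~w | Removed? w
  ... | inj₁ w≡v | _            = inj₁ w≡v
  ... | inj₂ _   | yes removed-w = inj₂ removed-w
  ... | inj₂ v~w | no kept-w     = ⊥-elim (kept-w (inj₂ (v~w , λ
      { (inj₁ N₁w) → ¬N₁⊎N₂u (inj₂ ((v~u , Removed⇒¬N₁ (inj₂ N₃u)) , w , u~w , N₁w))
      ; (inj₂ N₂w) → kept-w (inj₁ N₂w) })))

  N₃-dominator : ∀ {u D} → N₃ G v u → Dominating G D → ∃[ d ] (d ∈ D × (d ≡ v ⊎ Removed d))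
  N₃-dominator {u} N₃u domD with domD u
  ... | inj₁ u∈D = u , u∈D , inj₂ (inj₂ N₃u)
  ... | inj₂ (d , d∈D , u~d) = d , d∈D , N₃-adj⇒v⊎Removed N₃u u~d

module Rule1 {G : Graph} {v : V G} {G' : Graph} (R : IsRule1 G v G') where
  open IsRule1 R
  open Neighbourhoods G v

  collapse : V G → V G'
  collapse a with Removed? a
  ... | yes _ = emb v
  ... | no _  = emb a

  collapse-kept : ∀ {a} → Kept G v a → collapse a ≡ emb a
  collapse-kept {a} kept-a with Removed? a
  ... | yes removed-a = ⊥-elim (kept-a removed-a)
  ... | no _          = refl

  collapse-removed : ∀ {a} → Removed a → collapse a ≡ emb v
  collapse-removed {a} removed-a with Removed? a
  ... | yes _      = refl
  ... | no kept-a  = ⊥-elim (kept-a removed-a)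

  emb-v∈collapse : ∀ {D} → ∃ (N₃ G v) → Dominating G D → emb v ∈ map collapse D
  emb-v∈collapse (_ , N₃u) domD with N₃-dominator N₃u domD
  ... | (_ , d∈D , inj₁ refl)     = ∈-map⁺-≡ d∈D (collapse-kept Kept-v)
  ... | (_ , d∈D , inj₂ removed-d) = ∈-map⁺-≡ d∈D (collapse-removed removed-d)

  collapse-Dominating : ∀ {D} → ∃ (N₃ G v) → Dominating G D → Dominating G' (map collapse D)
  collapse-Dominating N₃≠∅ domD x with _≟_ G' x v'
  ... | yes refl = inj₂ (emb v , emb-v∈collapse N₃≠∅ domD , proj₂ (new-adj v Kept-v) refl)
  ... | no x≢v' with emb-sur x x≢v'
  ... | (a , kept-a , refl) with domD a
  ... | inj₁ a∈D = inj₁ (∈-map⁺-≡ a∈D (collapse-kept kept-a))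
  ... | inj₂ (d , d∈D , a~d) with Removed? d
  ... | no kept-d =
    inj₂ (emb d , ∈-map⁺-≡ d∈D (collapse-kept kept-d) , proj₂ (emb-adj a d kept-a kept-d) a~d)
  ... | yes removed-d with Removed-adj⇒Nc removed-d (sym G a~d)
  ... | inj₁ refl = inj₁ (emb-v∈collapse N₃≠∅ domD)
  ... | inj₂ v~a  =
    inj₂ (emb v , emb-v∈collapse N₃≠∅ domD , proj₂ (emb-adj a v kept-a Kept-v) (sym G v~a))

  restore : V G' → V G
  restore x with _≟_ G' x v'
  ... | yes _    = v
  ... | no x≢v'  = proj₁ (emb-sur x x≢v')

  restore-v' : restore v' ≡ v
  restore-v' with _≟_ G' v' v'
  ... | yes _      = refl
  ... | no v'≢v'   = ⊥-elim (v'≢v' refl)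

  restore-old : ∀ {x} → x ≢ v' → Kept G v (restore x) × emb (restore x) ≡ x
  restore-old {x} x≢v' with _≟_ G' x v'
  ... | yes x≡v'  = ⊥-elim (x≢v' x≡v')
  ... | no x≢v'   = proj₂ (emb-sur x x≢v')

  restore-emb : ∀ {a} → Kept G v a → restore (emb a) ≡ a
  restore-emb {a} kept-a with restore-old (emb-new a kept-a)
  ... | (kept-r , emb-r≡emb-a) = emb-inj (restore (emb a)) a kept-r kept-a emb-r≡emb-a

  v∈restore : ∀ {D'} → Dominating G' D' → v ∈ map restore D'
  v∈restore domD' with domD' v'
  ... | inj₁ v'∈D' = ∈-map⁺-≡ v'∈D' restore-v'
  ... | inj₂ (d , d∈D' , v'~d) with _≟_ G' d v'
  ... | yes refl = ⊥-elim (irrefl G' v'~d)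
  ... | no d≢v' with restore-old d≢v'
  ... | (kept-r , emb-r≡d) =
    ∈-map⁺-≡ d∈D' (proj₁ (new-adj (restore d) kept-r) (subst (Adj G' v') (≡.sym emb-r≡d) v'~d))

  restore-Dominating : ∀ {D'} → Dominating G' D' → Dominating G (map restore D')
  restore-Dominating domD' x with Removed? x
  ... | yes removed-x = inj₂ (v , v∈restore domD' , sym G (Removed⇒N removed-x))
  ... | no kept-x with domD' (emb x)
  ... | inj₁ x∈D' = inj₁ (∈-map⁺-≡ x∈D' (restore-emb kept-x))
  ... | inj₂ (d , d∈D' , x~d) with _≟_ G' d v'
  ... | yes refl with proj₁ (new-adj x kept-x) (sym G' x~d)
  ... | refl = inj₁ (v∈restore domD')
  restore-Dominating domD' x | no kept-x | inj₂ (d , d∈D' , x~d) | no d≢v'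
    with restore-old d≢v'
  ... | (kept-r , emb-r≡d) =
    inj₂ (restore d , ∈-map⁺-≡ d∈D' refl ,
          proj₁ (emb-adj x (restore d) kept-x kept-r) (subst (Adj G' (emb x)) (≡.sym emb-r≡d) x~d))

lemma1 : (G : Graph) (v : V G) → (∃[ u ] N₃ G v u) →
    (G' : Graph) → IsRule1 G v G' →
    ∀ (k : ℕ) → (IsDominationNumber G k → IsDominationNumber G' k) × (IsDominationNumber G' k → IsDominationNumber G k)
lemma1 G v N₃≠∅ G' R k =
  IsDominationNumber-transfer G G' G→G' G'→G , IsDominationNumber-transfer G' G G'→G G→G'
  where
  open Rule1 R
  G→G' : DominationTransfer G G'
  G→G' = DominationTransfer-map G G' collapse (λ _ → collapse-Dominating N₃≠∅)
  G'→G : DominationTransfer G' G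
  G'→G = DominationTransfer-map G' G restore (λ _ → restore-Dominating)
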